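{- For every labeled scheme $\mathfrak{l}$, the height of its root vertex is $0$.
   Context: A blossoming map is a map (cellular embedding of a connected graph in a compact orientable surface) with extra stems, each a leaf (towards its vertex) or a bud (away); interior degree ignores stems, degree counts them. Rooted: a marked root bud; root corner = corner immediately preceding it counterclockwise. A blossoming scheme is a unicellular (one-face) blossoming map all of whose vertices have interior degree at least $3$. It is well-oriented if each edge is oriented opposite to the direction of its first traversal by the clockwise contour (the walk along the face boundary from the root corner with the face on the right). A labeled scheme is a rooted, 4-valent (all degrees $4$), well-oriented blossoming scheme with a labeling of its corners by integers such that the root corner has label $0$ and any two corners consecutive around a vertex have labels differing by $1$, the larger one lying on the left of the separating half-edge (edge or stem, with its orientation). The height of a vertex is the minimum of the labels of its corners. -}

module Defs where

open import Data.Nat using (ℕ; zero; suc; _≤_)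
open import Data.Fin using (Fin; _≟_)
open import Data.Integer using (ℤ; _+_; _⊓_; 1ℤ; 0ℤ)
open import Data.Bool using (Bool; true; false; not)
open import Data.List using (List; map; upTo; filter; length; foldr)
open import Data.Product using (Σ; ∃; _×_; _,_)
open import Relation.Binary.PropositionalEquality using (_≡_; _≢_)
open import Relation.Nullary using (¬_; Dec; yes; no)
open import Relation.Nullary.Decidable using (¬?)

iter : ∀ {A : Set} → (A → A) → ℕ → A → A
iter f zero x = x
iter f (suc k) x = f (iter f k x)

-- reachability in the group generated by σ and α (finite, so forward steps suffice)
data Conn {n : ℕ} (σ α : Fin n → Fin n) : Fin n → Fin n → Set where
  here  : ∀ {h} → Conn σ α h h
  stepσ : ∀ {h h'} → Conn σ α (σ h) h' → Conn σ α h h'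
  stepα : ∀ {h h'} → Conn σ α (α h) h' → Conn σ α h h'

-- Combinatorial blossoming map on darts (half-edges) Fin n.
--  σ : counterclockwise rotation of darts around their vertex (vertices = σ-cycles)
--  α : involution; the 2-cycles of α are the edges, fixed points of α are the stems
--  out h = true  iff the dart h is oriented away from its vertex
--        (for a stem: bud = out, leaf = in; for an edge: its orientation)
record BlossomingMap : Set where
  field
    n        : ℕ
    σ        : Fin n → Fin n
    σ⁻       : Fin n → Fin n
    σσ⁻      : ∀ h → σ (σ⁻ h) ≡ h
    σ⁻σ      : ∀ h → σ⁻ (σ h) ≡ h
    α        : Fin n → Fin n
    αα       : ∀ h → α (α h) ≡ h
    out      : Fin n → Bool
    out-edge : ∀ h → α h ≢ h → out (α h) ≡ not (out h)
    connected : ∀ h h' → Conn σ α h h'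

module BM (M : BlossomingMap) where
  open BlossomingMap M

  IsStem : Fin n → Set
  IsStem h = α h ≡ h

  IsEdgeDart : Fin n → Set
  IsEdgeDart h = α h ≢ h

  scan : ℕ → Fin n → Fin n
  scan zero x = x
  scan (suc f) x with α x ≟ x
  ... | yes _ = scan f (σ x)
  ... | no _  = x

  -- clockwise contour (face on the right): after traversing the edge dart h
  -- (from its vertex to the vertex of α h) continue with the next edge dart
  -- counterclockwise after α h, skipping stems
  nextEdge : Fin n → Fin n
  nextEdge h = scan n (σ (α h))

  -- the contour from the corner preceding r counterclockwise:
  -- k-th traversed edge dart
  contour : Fin n → ℕ → Fin n
  contour r k = iter nextEdge k (scan n r)

  FirstBefore : Fin n → Fin n → Fin n → Set
  FirstBefore r h h' = ∃ λ k → contour r k ≡ h × (∀ j → j ≤ k → contour r j ≢ h')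

  Degree : Fin n → ℕ → Set
  Degree h d = 1 ≤ d × iter σ d h ≡ h × (∀ k → 1 ≤ k → suc k ≤ d → iter σ k h ≢ h)

  interiorCount : Fin n → ℕ → ℕ
  interiorCount h d = length (filter (λ x → ¬? (α x ≟ x)) (map (λ j → iter σ j h) (upTo d)))

  InteriorDegree≥3 : Fin n → Set
  InteriorDegree≥3 h = ∀ d → Degree h d → 3 ≤ interiorCount h d

-- labeling rule across a dart h: a = label of the corner before h (ccw),
-- b = label of the corner after h (ccw); the corner after h is on the left of h
-- iff h points away from its vertex.
LabelRule : Bool → ℤ → ℤ → Set
LabelRule true  a b = b ≡ a + 1ℤ
LabelRule false a b = a ≡ b + 1ℤ

-- Corners are indexed by darts: corner h is the corner between h and σ h.
record LabeledScheme : Set where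
  field
    bmap : BlossomingMap
  open BlossomingMap bmap public
  open BM bmap public
  field
    root        : Fin n
    root-stem   : IsStem root
    root-bud    : out root ≡ true
    -- unicellular: the contour from the root corner visits every edge dart
    unicellular : ∀ h → IsEdgeDart h → ∃ λ k → contour root k ≡ h
    interior≥3  : ∀ h → InteriorDegree≥3 h
    -- well-oriented: edges oriented opposite to their first traversal
    well-oriented : ∀ h → IsEdgeDart h → FirstBefore root h (α h) → out h ≡ false
    four-valent : ∀ h → Degree h 4
    label       : Fin n → ℤ
    label-root  : label (σ⁻ root) ≡ 0ℤ
    label-rule  : ∀ h → LabelRule (out h) (label (σ⁻ h)) (label h)

rootHeight : LabeledScheme → ℤ
rootHeight L = foldr _⊓_ (label root) (map (λ j → label (iter σ j root)) (upTo n))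
  where open LabeledScheme L

-- The root bud sits at a vertex with darts root, σ root, σ² root, σ³ root.  Since the
-- vertex has interior degree ≥ 3, the three darts other than the root bud are edge
-- darts.  The contour starts with σ root, so well-orientation makes σ root incoming.
-- The contour returns to its start right after traversing α (σ³ root), so σ³ root is
-- traversed before α (σ³ root) and is incoming as well.  Around the root vertex the
-- corner labels are therefore 1, 0, 1, 0, whose minimum is 0.
module Submission where

open import Defs
open import Data.Integer using (0ℤ)
open import Relation.Binary.PropositionalEquality using (_≡_)

open import Data.Bool using (true; false)
open import Data.Empty using (⊥-elim)
open import Data.Fin as Fin using (Fin)
open import Data.Integer using (ℤ; +_; 1ℤ; _+_; _⊓_; _≤_; +≤+)
open import Data.Integer.Properties using (≤-refl; ≤-antisym; ⊓-glb; i≤j⇒i⊓k≤j; i≤j⇒k⊓i≤j; +-0-abelianGroup)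
open import Algebra.Properties.AbelianGroup +-0-abelianGroup using (∙-cancelʳ)
open import Data.List using ([]; _∷_; map; upTo; length; foldr)
open import Data.List.Membership.Propositional using (_∈_; lose)
open import Data.List.Membership.Propositional.Properties using (∈-map⁺; ∈-upTo⁺)
open import Data.List.Properties using (filter-reject; filter-notAll; foldr-preservesᵇ; foldr-preservesᵒ)
open import Data.List.Relation.Unary.All using (All; universal)
open import Data.List.Relation.Unary.All.Properties using (map⁺)
import Data.List.Relation.Unary.Any as Any
open import Data.Nat as ℕ using (ℕ; zero; suc; _∸_; z≤n; s≤s; z<s)
open import Data.Nat.Induction using (<-rec)
open import Data.Nat.Properties using (anyUpTo?; m≤n⇒m<n∨m≡n; m∸n+n≡m; ∸-monoʳ-<; <⇒≱)
open import Data.Product using (∃; _×_; _,_; proj₁; proj₂; uncurry)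
open import Data.Sum using (inj₁; inj₂; [_,_])
open import Relation.Binary.Definitions using (DecidableEquality)
open import Relation.Binary.PropositionalEquality using (_≢_; ≢-sym; refl; sym; trans; cong; subst; module ≡-Reasoning)
open import Relation.Nullary using (Dec; yes; no; ¬?)

open ≡-Reasoning

iter-+ : ∀ {A : Set} (f : A → A) m n x → iter f (m ℕ.+ n) x ≡ iter f m (iter f n x)
iter-+ f zero    n x = refl
iter-+ f (suc m) n x = cong f (iter-+ f m n x)

iter-periodic : ∀ {A : Set} (f : A → A) {d x} → 0 ℕ.< d → iter f d x ≡ x →
                ∀ j → ∃ λ i → i ℕ.< d × iter f j x ≡ iter f i x
iter-periodic f d>0 fᵈx≡x zero = 0 , d>0 , refl
iter-periodic f d>0 fᵈx≡x (suc j) with iter-periodic f d>0 fᵈx≡x j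
... | i , i<d , fʲx≡fⁱx with m≤n⇒m<n∨m≡n i<d
...   | inj₁ 1+i<d = suc i , 1+i<d , cong f fʲx≡fⁱx
...   | inj₂ refl  = 0 , d>0 , trans (cong f fʲx≡fⁱx) fᵈx≡x

module _ {A : Set} (_≟_ : DecidableEquality A) (f : A → A) (x₀ : A) where

  orbit-reaches-before : ∀ {x y} → f y ≡ x₀ → x ≢ y → ∀ m → iter f m x₀ ≡ x →
                         ∃ λ k → iter f k x₀ ≡ x × (∀ j → j ℕ.≤ k → iter f j x₀ ≢ y)
  orbit-reaches-before {x} {y} fy≡x₀ x≢y = <-rec _ reach
    where
    Reach : ℕ → Set
    Reach m = iter f m x₀ ≡ x → ∃ λ k → iter f k x₀ ≡ x × (∀ j → j ℕ.≤ k → iter f j x₀ ≢ y)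

    shift : ∀ {j m} → iter f j x₀ ≡ y → j ℕ.< m → iter f (m ∸ suc j) x₀ ≡ iter f m x₀
    shift {j} {m} fʲx₀≡y j<m = begin
      iter f (m ∸ suc j) x₀                      ≡⟨ cong (iter f (m ∸ suc j)) (trans (cong f fʲx₀≡y) fy≡x₀) ⟨
      iter f (m ∸ suc j) (iter f (suc j) x₀)     ≡⟨ iter-+ f (m ∸ suc j) (suc j) x₀ ⟨
      iter f (m ∸ suc j ℕ.+ suc j) x₀            ≡⟨ cong (λ k → iter f k x₀) (m∸n+n≡m j<m) ⟩
      iter f m x₀                                ∎

    reach : ∀ m → (∀ {i} → i ℕ.< m → Reach i) → Reach m
    reach m earlier fᵐx₀≡x with anyUpTo? (λ j → iter f j x₀ ≟ y) (suc m)
    ... | no never = m , fᵐx₀≡x , λ j j≤m fʲx₀≡y → never (j , s≤s j≤m , fʲx₀≡y)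
    ... | yes (j , s≤s j≤m , fʲx₀≡y) with m≤n⇒m<n∨m≡n j≤m
    ...   | inj₂ refl = ⊥-elim (x≢y (trans (sym fᵐx₀≡x) fʲx₀≡y))
    ...   | inj₁ j<m  = earlier (∸-monoʳ-< z<s j<m) (trans (shift fʲx₀≡y j<m) fᵐx₀≡x)

two≤card : ∀ {n} {i j : Fin n} → i ≢ j → 2 ℕ.≤ n
two≤card {suc zero}    {Fin.zero} {Fin.zero} i≢j = ⊥-elim (i≢j refl)
two≤card {suc (suc n)}                _   = s≤s (s≤s z≤n)

foldr-⊓-≡ : ∀ {z a : ℤ} {xs} → z ≤ a → All (z ≤_) xs → z ∈ xs → foldr _⊓_ a xs ≡ z
foldr-⊓-≡ {z} {a} {xs} z≤a z≤xs z∈xs = ≤-antisym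
  (foldr-preservesᵒ {P = _≤ z} (λ x y → [ i≤j⇒i⊓k≤j y , i≤j⇒k⊓i≤j x ]) a xs (inj₂ (lose z∈xs ≤-refl)))
  (foldr-preservesᵇ {P = z ≤_} ⊓-glb z≤a z≤xs)

module _ (M : BlossomingMap) where
  open BlossomingMap M
  open BM M

  scan-stem : ∀ f {x} → IsStem x → scan (suc f) x ≡ scan f (σ x)
  scan-stem f {x} stem with α x Fin.≟ x
  ... | yes _     = refl
  ... | no ¬stem  = ⊥-elim (¬stem stem)

  scan-edge : ∀ f {x} → IsEdgeDart x → scan (suc f) x ≡ x
  scan-edge f {x} edge with α x Fin.≟ x
  ... | yes stem = ⊥-elim (edge stem)
  ... | no _     = refl

module _ (L : LabeledScheme) where
  open LabeledScheme L

  edges-around-stem : ∀ {h} → IsStem h → ∀ {x} → x ∈ σ h ∷ σ (σ h) ∷ σ (σ (σ h)) ∷ [] → IsEdgeDart x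
  edges-around-stem {h} stem x∈ x-stem = <⇒≱ fewer-than-3 (interior≥3 h 4 (four-valent h))
    where
    isEdge? : (y : Fin n) → Dec (IsEdgeDart y)
    isEdge? y = ¬? (α y Fin.≟ y)
    fewer-than-3 : interiorCount h 4 ℕ.< 3
    fewer-than-3 = subst (ℕ._< 3) (cong length (sym (filter-reject isEdge? λ edge → edge stem)))
      (filter-notAll isEdge? _ (Any.map (λ { refl edge → edge x-stem }) x∈))

  label-out : ∀ {h} → out h ≡ true → label h ≡ label (σ⁻ h) + 1ℤ
  label-out {h} isOut = subst (λ b → LabelRule b (label (σ⁻ h)) (label h)) isOut (label-rule h)

  label-in : ∀ {h} → out h ≡ false → label (σ⁻ h) ≡ label h + 1ℤ
  label-in {h} isIn = subst (λ b → LabelRule b (label (σ⁻ h)) (label h)) isIn (label-rule h)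

  private
    e₁ e₂ e₃ : Fin n
    e₁ = σ root
    e₂ = σ e₁
    e₃ = σ e₂

    σe₃≡root : σ e₃ ≡ root
    σe₃≡root = proj₁ (proj₂ (four-valent root))

    root≢e₁ : root ≢ e₁
    root≢e₁ eq = proj₂ (proj₂ (four-valent root)) 1 (s≤s z≤n) (s≤s (s≤s z≤n)) (sym eq)

    e₁-edge : IsEdgeDart e₁
    e₁-edge = edges-around-stem root-stem (Any.here refl)

    e₃-edge : IsEdgeDart e₃
    e₃-edge = edges-around-stem root-stem (Any.there (Any.there (Any.here refl)))

    -- scan runs on fuel n, so its two steps need n ≥ 2.
    contour-start : contour root 0 ≡ e₁
    contour-start with two≤card root≢e₁
    ... | s≤s (s≤s _) = trans (scan-stem bmap _ root-stem) (scan-edge bmap _ e₁-edge)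

    e₁-in : out e₁ ≡ false
    e₁-in = well-oriented e₁ e₁-edge
      (0 , contour-start , λ { zero _ e₁≡αe₁ → ≢-sym e₁-edge (trans (sym contour-start) e₁≡αe₁) })

    e₃-in : out e₃ ≡ false
    e₃-in = well-oriented e₃ e₃-edge (uncurry (orbit-reaches-before Fin._≟_ nextEdge (scan n root)
      {y = α e₃} (cong (scan n) (trans (cong σ (αα e₃)) σe₃≡root)) (≢-sym e₃-edge))
      (unicellular e₃ e₃-edge))

    label-root≡1 : label root ≡ 1ℤ
    label-root≡1 = trans (label-out root-bud) (cong (_+ 1ℤ) label-root)

    label-e₃≡0 : label e₃ ≡ 0ℤ
    label-e₃≡0 = trans (cong label (sym (trans (cong σ⁻ (sym σe₃≡root)) (σ⁻σ e₃)))) label-root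

    label-e₂≡1 : label e₂ ≡ 1ℤ
    label-e₂≡1 = trans (cong label (sym (σ⁻σ e₂))) (trans (label-in e₃-in) (cong (_+ 1ℤ) label-e₃≡0))

  2≤n : 2 ℕ.≤ n
  2≤n = two≤card root≢e₁

  label-σroot≡0 : label (σ root) ≡ 0ℤ
  label-σroot≡0 = ∙-cancelʳ 1ℤ (label e₁) 0ℤ
    (trans (sym (label-in e₁-in)) (trans (cong label (σ⁻σ root)) label-root≡1))

  root-corner-labels-nonneg : ∀ j → 0ℤ ≤ label (iter σ j root)
  root-corner-labels-nonneg j with iter-periodic σ {d = 4} (s≤s z≤n) σe₃≡root j
  ... | i , i<4 , σʲroot≡σⁱroot = subst (λ h → 0ℤ ≤ label h) (sym σʲroot≡σⁱroot) (corner-nonneg i<4)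
    where
    nonneg : ∀ {x k} → x ≡ + k → 0ℤ ≤ x
    nonneg x≡k = subst (0ℤ ≤_) (sym x≡k) (+≤+ z≤n)

    corner-nonneg : ∀ {i} → i ℕ.< 4 → 0ℤ ≤ label (iter σ i root)
    corner-nonneg {0} _ = nonneg label-root≡1
    corner-nonneg {1} _ = nonneg label-σroot≡0
    corner-nonneg {2} _ = nonneg label-e₂≡1
    corner-nonneg {3} _ = nonneg label-e₃≡0
    corner-nonneg {suc (suc (suc (suc _)))} (s≤s (s≤s (s≤s (s≤s ()))))

claim5p7 : (L : LabeledScheme) → rootHeight L ≡ 0ℤ
claim5p7 L = foldr-⊓-≡
  (root-corner-labels-nonneg L 0)
  (map⁺ (universal (root-corner-labels-nonneg L) (upTo n)))
  (subst (_∈ map corner-label (upTo n)) (label-σroot≡0 L) (∈-map⁺ corner-label (∈-upTo⁺ (2≤n L))))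
  where
  open LabeledScheme L
  corner-label : ℕ → ℤ
  corner-label j = label (iter σ j root)
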